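{- Let $G$ be a finite group and $n\ge 0$. Then the frame matroids $M_\times(K_n^G)$ and $M_\times(\mathring{K}_n^G)$ are round, with the single exception of $M_\times(K_2^G)$ when $|G|=2$ (i.e. $M_\times(K_2^{\{\pm1\}})$).
   Context: A gain graph $\Gamma=(V_\Gamma,E_\Gamma,L_\Gamma,G_\Gamma)$ consists of a finite vertex set $V_\Gamma$, a set $L_\Gamma\subseteq V_\Gamma$ of loops (at most one loop per vertex), a group $G_\Gamma$ (gain group), and a finite set $E_\Gamma$ of edges, each edge being a class $\{u,v\}_g$ of triples $(u,v,g)$ with $u\ne v$, $g\in G_\Gamma$, under the identification $(u,v,g)\sim(v,u,g^{ -1})$. A cycle is either a loop or a set of edges $\{v_1,v_2\}_{g_1},\{v_2,v_3\}_{g_2},\dots,\{v_m,v_1\}_{g_m}$ on distinct vertices $v_1,\dots,v_m$, $m\ge2$ (when $m=2$ the two edges must be distinct); it is balanced if $g_1g_2\cdots g_m=1$, and loops are unbalanced. The frame matroid $M_\times(\Gamma)$ is the matroid on $E_\Gamma\sqcup L_\Gamma$ in which a subset $S$ is independent iff every connected component of the gain graph $(V_\Gamma,S\cap E_\Gamma,S\cap L_\Gamma,G_\Gamma)$ contains no balanced cycle and at most one unbalanced cycle. $K_n^G$ is the loopless gain graph on $[n]$ with gain group $G$ and all edges $\{i,j\}_g$, $i\ne j$, $g\in G$; $\mathring{K}_n^G$ is $K_n^G$ with a loop at every vertex. A matroid is round if its ground set is not the union of two proper flats. -}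

module Defs where

open import Data.Nat using (ℕ; _≤_)
open import Data.Fin using (Fin) renaming (_<_ to _<ᶠ_)
open import Data.Bool using (Bool; true; false; T)
open import Data.List using (List; []; _∷_; length)
open import Data.List.Membership.Propositional using (_∈_)
open import Data.List.Relation.Unary.Unique.Propositional using (Unique)
open import Data.Product using (Σ; ∃; ∃-syntax; _×_)
open import Data.Sum using (_⊎_)
open import Data.Empty using (⊥)
open import Relation.Nullary using (¬_)
open import Relation.Binary.PropositionalEquality using (_≡_)
open import Function.Bundles using (_⇔_)
open import Algebra.Core using (Op₁; Op₂)
open import Algebra.Structures using (IsGroup)

-- A finite group, presented (up to isomorphism) on the carrier Fin order.
record FiniteGroup : Set where
  field
    order   : ℕ
    _∙_     : Op₂ (Fin order)
    ε       : Fin order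
    _⁻¹     : Op₁ (Fin order)
    isGroup : IsGroup _≡_ _∙_ ε _⁻¹

-- The frame matroid of K_n^G (lp = false) or of K̊_n^G (lp = true).
module Frame (Γ : FiniteGroup) (n : ℕ) (lp : Bool) where
  open FiniteGroup Γ

  Gain : Set
  Gain = Fin order

  -- Ground set: edges {i,j}_g represented canonically as (i,j,g) with i < j,
  -- and (when lp = true) one loop at each vertex.
  data Elem : Set where
    edge : (i j : Fin n) → i <ᶠ j → Gain → Elem
    loop : T lp → Fin n → Elem

  Subset : Set
  Subset = Elem → Bool

  _∈ₛ_ : Elem → Subset → Set
  e ∈ₛ S = S e ≡ true

  _⊆ₛ_ : Subset → Subset → Set
  S ⊆ₛ T′ = ∀ e → e ∈ₛ S → e ∈ₛ T′


  data Step : Elem → Fin n → Fin n → Gain → Set where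
    fwd : ∀ {i j} (p : i <ᶠ j) (g : Gain) → Step (edge i j p g) i j g
    bwd : ∀ {i j} (p : i <ᶠ j) (g : Gain) → Step (edge i j p g) j i (g ⁻¹)

  data Walk (S : Subset) : Fin n → Fin n → List (Fin n) → List Elem → Gain → Set where
    []  : ∀ {v} → Walk S v v [] [] ε
    step : ∀ {u w v vs es e g h} → e ∈ₛ S → Step e u w g →
           Walk S w v vs es h → Walk S u v (u ∷ vs) (e ∷ es) (g ∙ h)

  Connected : Subset → Fin n → Fin n → Set
  Connected S u v = ∃[ vs ] ∃[ es ] ∃[ g ] Walk S u v vs es g

  data Cycle (S : Subset) : Set where
    loopC  : (t : T lp) (v : Fin n) → loop t v ∈ₛ S → Cycle S
    closed : (v : Fin n) (vs : List (Fin n)) (es : List Elem) (g : Gain) →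
             Walk S v v vs es g → 2 ≤ length es → Unique vs → Unique es → Cycle S

  Balanced : ∀ {S} → Cycle S → Set
  Balanced (loopC _ _ _) = ⊥
  Balanced (closed _ _ _ g _ _ _ _) = g ≡ ε

  cycleEdges : ∀ {S} → Cycle S → List Elem
  cycleEdges (loopC t v _) = loop t v ∷ []
  cycleEdges (closed _ _ es _ _ _ _ _) = es

  cycleVertex : ∀ {S} → Cycle S → Fin n
  cycleVertex (loopC _ v _) = v
  cycleVertex (closed v _ _ _ _ _ _ _) = v

  SameCycle : ∀ {S} → Cycle S → Cycle S → Set
  SameCycle C D = ∀ e → (e ∈ cycleEdges C) ⇔ (e ∈ cycleEdges D)

  Independent : Subset → Set
  Independent S =
    (∀ (C : Cycle S) → ¬ Balanced C) ×
    (∀ (C D : Cycle S) → ¬ Balanced C → ¬ Balanced D →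
       Connected S (cycleVertex C) (cycleVertex D) → SameCycle C D)

  -- I ∪ {e}, via a decidable-free description: any subset J with
  -- J ⊇ I, e ∈ J and J ⊆ I ∪ {e}.
  IsInsert : Subset → Elem → Subset → Set
  IsInsert I e J = (I ⊆ₛ J) × (e ∈ₛ J) × (∀ x → x ∈ₛ J → x ∈ₛ I ⊎ x ≡ e)

  InClosure : Subset → Elem → Set
  InClosure F e = ∃[ I ] ∃[ J ] (I ⊆ₛ F × Independent I × IsInsert I e J × ¬ Independent J)

  Flat : Subset → Set
  Flat F = ∀ e → InClosure F e → e ∈ₛ F

  Proper : Subset → Set
  Proper F = ∃[ e ] F e ≡ false

  Round : Set
  Round = ¬ (∃[ F₁ ] ∃[ F₂ ] (Flat F₁ × Flat F₂ × Proper F₁ × Proper F₂ ×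
                              (∀ e → e ∈ₛ F₁ ⊎ e ∈ₛ F₂)))

IsRoundFrame : FiniteGroup → ℕ → Bool → Set
IsRoundFrame Γ n withLoops = Frame.Round Γ n withLoops

-- Any two elements of M_×(K_n^G) or M_×(K̊_n^G) are independent, so a flat containing x and y
-- contains every e with {x, y, e} dependent.  Suppose the ground set is F₁ ∪ F₂ for proper flats
-- and f ∉ F₂.  For every dependent triple {f, y, z} we get y ∈ F₁: otherwise y ∈ F₂, and then
-- z ∈ F₁ puts y into the closure of {f, z} ⊆ F₁, while z ∈ F₂ puts f into the closure of
-- {y, z} ⊆ F₂.  The dependent triples through f (two loops joined by an edge, balanced triangles,
-- three parallel edges with distinct gains) carry F₁ onto every edge and loop at one endpoint of
-- f, and from this star onto everything, so F₁ is not proper.  Only for K₂^G with |G| = 2 are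
-- there no such triples: its two edges are parallel and each of them forms a flat on its own.
module Submission where

open import Defs
open import Data.Nat using (ℕ; zero; suc; _≤_; z≤n; s≤s)
open import Data.Fin using (Fin; zero; suc) renaming (_<_ to _<ᶠ_)
open import Data.Fin.Properties using (<-cmp; <-irrelevant; <-irrefl; <-asym) renaming (_≟_ to _≟ᶠ_)
open import Data.Bool using (Bool; false; T; T?; not)
open import Data.Bool.Properties using (T-irrelevant; T-≡; ¬-not; not-¬)
open import Data.List using (List; []; _∷_; length)
open import Data.List.Membership.Propositional using (_∈_)
open import Data.List.Membership.Propositional.Properties using (∈-++⁻)
open import Data.List.Relation.Binary.Subset.Propositional using (_⊆_)
open import Data.List.Relation.Binary.Subset.Propositional.Properties using (xs⊆xs++ys)
open import Data.List.Relation.Unary.Any using (here; there)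
open import Data.List.Relation.Unary.Any.Properties using (singleton⁻)
open import Data.List.Relation.Unary.AllPairs using ([]; _∷_)
open import Data.List.Relation.Unary.All using ([]; _∷_)
open import Data.List.Relation.Unary.Unique.Propositional using (Unique)
open import Data.Product using (∃-syntax; _×_; _,_; proj₁; proj₂)
open import Data.Sum using (_⊎_; inj₁; inj₂; [_,_]′) renaming (map to ⊎-map)
open import Data.Empty using (⊥; ⊥-elim)
import Data.Empty.Irrelevant as Irrelevant
open import Function using (id; _∘_)
open import Function.Bundles using (_⇔_; mk⇔; Equivalence)
open import Relation.Nullary using (¬_; yes; no; does)
open import Relation.Nullary.Decidable using (dec-true; dec-false)
open import Relation.Binary.Definitions using (DecidableEquality; tri<; tri≈; tri>)
open import Relation.Binary.PropositionalEquality
  using (_≡_; _≢_; refl; sym; trans; cong; subst; subst₂; ≢-sym; module ≡-Reasoning)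
open import Algebra.Bundles using (Group)
open import Algebra.Structures using (IsGroup)
import Algebra.Properties.Group as GroupProperties

Exceptional : FiniteGroup → ℕ → Bool → Set
Exceptional Γ n withLoops = withLoops ≡ false × n ≡ 2 × FiniteGroup.order Γ ≡ 2

module _ {ℓ} {A : Set ℓ} {x y : A} where

  ∈-pair⁻ : ∀ {e} → e ∈ x ∷ y ∷ [] → e ≡ x ⊎ e ≡ y
  ∈-pair⁻ (here e≡x)         = inj₁ e≡x
  ∈-pair⁻ (there (here e≡y)) = inj₂ e≡y

  pair⊆distinct : ∀ {a b} → a ≢ b → a ∈ x ∷ y ∷ [] → b ∈ x ∷ y ∷ [] → x ∷ y ∷ [] ⊆ a ∷ b ∷ []
  pair⊆distinct a≢b a∈ b∈ e∈ with ∈-pair⁻ a∈ | ∈-pair⁻ b∈ | ∈-pair⁻ e∈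
  ... | inj₁ refl | inj₁ refl | _         = ⊥-elim (a≢b refl)
  ... | inj₂ refl | inj₂ refl | _         = ⊥-elim (a≢b refl)
  ... | inj₁ refl | inj₂ refl | inj₁ refl = here refl
  ... | inj₁ refl | inj₂ refl | inj₂ refl = there (here refl)
  ... | inj₂ refl | inj₁ refl | inj₁ refl = there (here refl)
  ... | inj₂ refl | inj₁ refl | inj₂ refl = here refl

  unique⊆pair⇒length≤2 : ∀ {es} → Unique es → es ⊆ x ∷ y ∷ [] → length es ≤ 2
  unique⊆pair⇒length≤2 {[]}         _ _ = z≤n
  unique⊆pair⇒length≤2 {_ ∷ []}     _ _ = s≤s z≤n
  unique⊆pair⇒length≤2 {_ ∷ _ ∷ []} _ _ = s≤s (s≤s z≤n)
  unique⊆pair⇒length≤2 {_ ∷ _ ∷ _ ∷ _} ((a≢b ∷ a≢c ∷ _) ∷ (b≢c ∷ _) ∷ _) es⊆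
    with pair⊆distinct a≢b (es⊆ (here refl)) (es⊆ (there (here refl))) (es⊆ (there (there (here refl))))
  ... | here c≡a         = ⊥-elim (a≢c (sym c≡a))
  ... | there (here c≡b) = ⊥-elim (b≢c (sym c≡b))

  unique⊆pair⇒⊇ : ∀ {es} → Unique es → es ⊆ x ∷ y ∷ [] → 2 ≤ length es → x ∷ y ∷ [] ⊆ es
  unique⊆pair⇒⊇ {_ ∷ []}    _ _ (s≤s ())
  unique⊆pair⇒⊇ {_ ∷ _ ∷ _} ((a≢b ∷ _) ∷ _) es⊆ _ e∈
    with pair⊆distinct a≢b (es⊆ (here refl)) (es⊆ (there (here refl))) e∈
  ... | here e≡a         = here e≡a
  ... | there (here e≡b) = there (here e≡b)

third⊎≡2 : ∀ {m} (x y : Fin m) → x ≢ y → (∃[ w ] w ≢ x × w ≢ y) ⊎ m ≡ 2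
third⊎≡2 {1} zero zero x≢y = ⊥-elim (x≢y refl)
third⊎≡2 {2} _    _    _   = inj₂ refl
third⊎≡2 {suc (suc (suc _))} = λ where
  zero          zero          x≢y → ⊥-elim (x≢y refl)
  zero          (suc zero)    _   → inj₁ (suc (suc zero) , (λ ()) , (λ ()))
  zero          (suc (suc _)) _   → inj₁ (suc zero , (λ ()) , (λ ()))
  (suc zero)    zero          _   → inj₁ (suc (suc zero) , (λ ()) , (λ ()))
  (suc zero)    (suc zero)    x≢y → ⊥-elim (x≢y refl)
  (suc zero)    (suc (suc _)) _   → inj₁ (zero , (λ ()) , (λ ()))
  (suc (suc _)) zero          _   → inj₁ (suc zero , (λ ()) , (λ ()))
  (suc (suc _)) (suc zero)    _   → inj₁ (zero , (λ ()) , (λ ()))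
  (suc (suc _)) (suc (suc _)) _   → inj₁ (zero , (λ ()) , (λ ()))

-- The size is an equation rather than the literal 2 so that it applies to a group order.
≢-same⇒≡ : ∀ {m} → m ≡ 2 → {a b c : Fin m} → a ≢ c → b ≢ c → a ≡ b
≢-same⇒≡ refl {zero}     {zero}     {_}        _   _   = refl
≢-same⇒≡ refl {suc zero} {suc zero} {_}        _   _   = refl
≢-same⇒≡ refl {zero}     {suc zero} {zero}     a≢c _   = ⊥-elim (a≢c refl)
≢-same⇒≡ refl {zero}     {suc zero} {suc zero} _   b≢c = ⊥-elim (b≢c refl)
≢-same⇒≡ refl {suc zero} {zero}     {zero}     _   b≢c = ⊥-elim (b≢c refl)
≢-same⇒≡ refl {suc zero} {zero}     {suc zero} a≢c _   = ⊥-elim (a≢c refl)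

∃≢ : ∀ {m} → m ≡ 2 → (c : Fin m) → ∃[ h ] h ≢ c
∃≢ refl zero       = suc zero , λ ()
∃≢ refl (suc zero) = zero , λ ()

module FrameMatroid (Γ : FiniteGroup) (n : ℕ) (lp : Bool) where
  open FiniteGroup Γ
  open Frame Γ n lp
  open IsGroup isGroup using (assoc; identityˡ; identityʳ; inverseʳ)

  group : Group _ _
  group = record { isGroup = isGroup }
  open GroupProperties group using (inverseˡ-unique; ⁻¹-involutive; ⁻¹-injective)

  digon-balanced : ∀ g h → g ∙ (h ∙ ε) ≡ ε → g ≡ h ⁻¹
  digon-balanced g h gh≡ε = inverseˡ-unique g h (trans (cong (g ∙_) (sym (identityʳ h))) gh≡ε)

  digon-balanced′ : ∀ g h → g ∙ ((h ⁻¹) ∙ ε) ≡ ε → g ≡ h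
  digon-balanced′ g h gh⁻¹≡ε = trans (digon-balanced g (h ⁻¹) gh⁻¹≡ε) (⁻¹-involutive h)

  triangle-balanced : ∀ a b → a ∙ (b ∙ (((a ∙ b) ⁻¹) ∙ ε)) ≡ ε
  triangle-balanced a b = begin
    a ∙ (b ∙ (((a ∙ b) ⁻¹) ∙ ε)) ≡⟨ cong (λ z → a ∙ (b ∙ z)) (identityʳ _) ⟩
    a ∙ (b ∙ ((a ∙ b) ⁻¹))     ≡⟨ assoc a b _ ⟨
    (a ∙ b) ∙ ((a ∙ b) ⁻¹)     ≡⟨ inverseʳ (a ∙ b) ⟩
    ε                          ∎
    where open ≡-Reasoning

  ∙-⁻¹-cancel : ∀ a c → a ∙ ((a ⁻¹) ∙ c) ≡ c
  ∙-⁻¹-cancel a c = begin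
    a ∙ ((a ⁻¹) ∙ c) ≡⟨ assoc a (a ⁻¹) c ⟨
    (a ∙ (a ⁻¹)) ∙ c ≡⟨ cong (_∙ c) (inverseʳ a) ⟩
    ε ∙ c          ≡⟨ identityˡ c ⟩
    c              ∎
    where open ≡-Reasoning

  edge-cong : ∀ {i j} (p p′ : i <ᶠ j) {g g′} → g ≡ g′ → edge i j p g ≡ edge i j p′ g′
  edge-cong p p′ refl = cong (λ q → edge _ _ q _) (<-irrelevant p p′)

  _≟ₑ_ : DecidableEquality Elem
  edge i j p g ≟ₑ edge i′ j′ p′ g′ with i ≟ᶠ i′ | j ≟ᶠ j′ | g ≟ᶠ g′
  ... | yes refl | yes refl | yes refl = yes (edge-cong p p′ refl)
  ... | no i≢i′  | _        | _        = no λ { refl → i≢i′ refl }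
  ... | yes _    | no j≢j′  | _        = no λ { refl → j≢j′ refl }
  ... | yes _    | yes _    | no g≢g′  = no λ { refl → g≢g′ refl }
  edge _ _ _ _ ≟ₑ loop _ _ = no λ ()
  loop _ _ ≟ₑ edge _ _ _ _ = no λ ()
  loop t v ≟ₑ loop t′ v′ with v ≟ᶠ v′
  ... | yes refl = yes (cong (λ s → loop s v) (T-irrelevant t t′))
  ... | no v≢v′  = no λ { refl → v≢v′ refl }

  open import Data.List.Membership.DecPropositional _≟ₑ_ using (_∈?_)

  ⟦_⟧ : List Elem → Subset
  ⟦ xs ⟧ e = does (e ∈? xs)

  ∈⟦⟧⁺ : ∀ {e} xs → e ∈ xs → e ∈ₛ ⟦ xs ⟧
  ∈⟦⟧⁺ {e} xs = dec-true (e ∈? xs)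

  ∈⟦⟧⁻ : ∀ {e xs} → e ∈ₛ ⟦ xs ⟧ → e ∈ xs
  ∈⟦⟧⁻ {e} {xs} with e ∈? xs
  ... | yes e∈xs = λ _ → e∈xs
  ... | no _     = λ ()

  ⟦⟧-mono : ∀ {xs ys} → xs ⊆ ys → ⟦ xs ⟧ ⊆ₛ ⟦ ys ⟧
  ⟦⟧-mono {ys = ys} xs⊆ys _ = ∈⟦⟧⁺ ys ∘ xs⊆ys ∘ ∈⟦⟧⁻

  walk-mono : ∀ {S T u v vs es g} → S ⊆ₛ T → Walk S u v vs es g → Walk T u v vs es g
  walk-mono S⊆T []             = []
  walk-mono S⊆T (step e∈ s w) = step (S⊆T _ e∈) s (walk-mono S⊆T w)

  cycle-mono : ∀ {S T} → S ⊆ₛ T → Cycle S → Cycle T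
  cycle-mono S⊆T (loopC t v l∈)             = loopC t v (S⊆T _ l∈)
  cycle-mono S⊆T (closed v vs es g w l u u′) = closed v vs es g (walk-mono S⊆T w) l u u′

  balanced-mono : ∀ {S T} (S⊆T : S ⊆ₛ T) (C : Cycle S) → Balanced (cycle-mono S⊆T C) ≡ Balanced C
  balanced-mono _ (loopC _ _ _)            = refl
  balanced-mono _ (closed _ _ _ _ _ _ _ _) = refl

  cycleEdges-mono : ∀ {S T} (S⊆T : S ⊆ₛ T) (C : Cycle S) → cycleEdges (cycle-mono S⊆T C) ≡ cycleEdges C
  cycleEdges-mono _ (loopC _ _ _)            = refl
  cycleEdges-mono _ (closed _ _ _ _ _ _ _ _) = refl

  cycleVertex-mono : ∀ {S T} (S⊆T : S ⊆ₛ T) (C : Cycle S) → cycleVertex (cycle-mono S⊆T C) ≡ cycleVertex C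
  cycleVertex-mono _ (loopC _ _ _)            = refl
  cycleVertex-mono _ (closed _ _ _ _ _ _ _ _) = refl

  independent-⊆ : ∀ {S T} → S ⊆ₛ T → Independent T → Independent S
  independent-⊆ {S} {T} S⊆T (noBalanced , oneUnbalanced) = noBalanced′ , oneUnbalanced′
    where
    lift : Cycle S → Cycle T
    lift = cycle-mono S⊆T

    noBalanced′ : ∀ (C : Cycle S) → ¬ Balanced C
    noBalanced′ C = noBalanced (lift C) ∘ subst id (sym (balanced-mono S⊆T C))

    oneUnbalanced′ : ∀ (C D : Cycle S) → ¬ Balanced C → ¬ Balanced D →
                     Connected S (cycleVertex C) (cycleVertex D) → SameCycle C D
    oneUnbalanced′ C D ¬bC ¬bD (vs , es , g , w) =
      subst₂ (λ X Y → ∀ e → (e ∈ X) ⇔ (e ∈ Y)) (cycleEdges-mono S⊆T C) (cycleEdges-mono S⊆T D)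
        (oneUnbalanced (lift C) (lift D)
          (¬bC ∘ subst id (balanced-mono S⊆T C)) (¬bD ∘ subst id (balanced-mono S⊆T D))
          (vs , es , g , subst₂ (λ a b → Walk T a b vs es g)
                           (sym (cycleVertex-mono S⊆T C)) (sym (cycleVertex-mono S⊆T D)) (walk-mono S⊆T w)))

  Dependent : Subset → Set
  Dependent S = ¬ Independent S

  dependent-⊆ : ∀ {xs ys} → xs ⊆ ys → Dependent ⟦ xs ⟧ → Dependent ⟦ ys ⟧
  dependent-⊆ xs⊆ys dep = dep ∘ independent-⊆ (⟦⟧-mono xs⊆ys)

  Dependent₃ : Elem → Elem → Elem → Set
  Dependent₃ x y z = Dependent ⟦ x ∷ y ∷ z ∷ [] ⟧

  dependent₃-swap₁₂ : ∀ {x y z} → Dependent₃ x y z → Dependent₃ y x z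
  dependent₃-swap₁₂ {x} {y} {z} = dependent-⊆ {x ∷ y ∷ z ∷ []} {y ∷ x ∷ z ∷ []} λ where
    (here p)          → there (here p)
    (there (here p))  → here p
    (there (there p)) → there (there p)

  dependent₃-swap₂₃ : ∀ {x y z} → Dependent₃ x y z → Dependent₃ x z y
  dependent₃-swap₂₃ {x} {y} {z} = dependent-⊆ {x ∷ y ∷ z ∷ []} {x ∷ z ∷ y ∷ []} λ where
    (here p)                 → here p
    (there (here p))         → there (there (here p))
    (there (there (here p))) → there (here p)

  data IsLoop : Elem → Set where
    loop : ∀ t v → IsLoop (loop t v)

  step-¬loop : ∀ {e u w g} → Step e u w g → ¬ IsLoop e
  step-¬loop (fwd _ _) ()
  step-¬loop (bwd _ _) ()

  balanced-digon⇒≡ : ∀ {a b v w g h} → Step a v w g → Step b w v h → g ∙ (h ∙ ε) ≡ ε → a ≡ b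
  balanced-digon⇒≡ (fwd p _) (fwd p′ _) _ = ⊥-elim (<-asym p p′)
  balanced-digon⇒≡ (bwd p _) (bwd p′ _) _ = ⊥-elim (<-asym p p′)
  balanced-digon⇒≡ (fwd p g) (bwd p′ h) gh≡ε =
    edge-cong p p′ (digon-balanced′ g h gh≡ε)
  balanced-digon⇒≡ (bwd p g) (fwd p′ h) gh≡ε =
    edge-cong p p′ (⁻¹-injective (digon-balanced (g ⁻¹) h gh≡ε))

  digon : ∀ {S u v e f g h} → u ≢ v → e ≢ f → e ∈ₛ S → f ∈ₛ S → Step e u v g → Step f v u h → Cycle S
  digon u≢v e≢f e∈ f∈ s s′ =
    closed _ _ _ _ (step e∈ s (step f∈ s′ [])) (s≤s (s≤s z≤n))
      ((u≢v ∷ []) ∷ [] ∷ []) ((e≢f ∷ []) ∷ [] ∷ [])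

  walk-edges∈ : ∀ {S u v vs es g e} → Walk S u v vs es g → e ∈ es → e ∈ₛ S
  walk-edges∈ (step e∈S _ _) (here refl) = e∈S
  walk-edges∈ (step _ _ w)   (there e∈)  = walk-edges∈ w e∈

  walk-edges-¬loop : ∀ {S u v vs es g e} → Walk S u v vs es g → e ∈ es → ¬ IsLoop e
  walk-edges-¬loop (step _ s _) (here refl) = step-¬loop s
  walk-edges-¬loop (step _ _ w) (there e∈)  = walk-edges-¬loop w e∈

  walk-edges⊆ : ∀ {xs u v vs es g} → Walk ⟦ xs ⟧ u v vs es g → es ⊆ xs
  walk-edges⊆ w = ∈⟦⟧⁻ ∘ walk-edges∈ w

  module _ (x y : Elem) where

    closed-in-pair-unbalanced : ∀ {v vs es g} → Walk ⟦ x ∷ y ∷ [] ⟧ v v vs es g →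
                                2 ≤ length es → Unique es → g ≢ ε
    closed-in-pair-unbalanced []                         ()          _
    closed-in-pair-unbalanced (step _ _ [])              (s≤s ())    _
    closed-in-pair-unbalanced (step _ s (step _ s′ [])) _ ((a≢b ∷ []) ∷ _) =
      a≢b ∘ balanced-digon⇒≡ s s′
    closed-in-pair-unbalanced w@(step _ _ (step _ _ (step _ _ _))) _ u
      with unique⊆pair⇒length≤2 u (walk-edges⊆ w)
    ... | s≤s (s≤s ())

    closed-in-pair-covers : ∀ {v vs es g} → Walk ⟦ x ∷ y ∷ [] ⟧ v v vs es g →
                            2 ≤ length es → Unique es → x ∷ y ∷ [] ⊆ es
    closed-in-pair-covers w l u = unique⊆pair⇒⊇ u (walk-edges⊆ w) l

    -- Distinct loops would make every element of the pair a loop, leaving no edge to walk along.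
    loops-in-pair-connected⇒≡ : ∀ {t t′ v v′} →
                                loop t v ∈ₛ ⟦ x ∷ y ∷ [] ⟧ → loop t′ v′ ∈ₛ ⟦ x ∷ y ∷ [] ⟧ →
                                Connected ⟦ x ∷ y ∷ [] ⟧ v v′ → loop t v ≡ loop t′ v′
    loops-in-pair-connected⇒≡ {t} {t′} {v} _ _ (_ , _ , _ , []) = cong (λ s → loop s v) (T-irrelevant t t′)
    loops-in-pair-connected⇒≡ {t} {t′} {v} {v′} l∈ l′∈ (_ , _ , _ , step e∈ s _)
      with loop t v ≟ₑ loop t′ v′
    ... | yes l≡l′ = l≡l′
    ... | no l≢l′ with pair⊆distinct l≢l′ (∈⟦⟧⁻ l∈) (∈⟦⟧⁻ l′∈) (∈⟦⟧⁻ e∈)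
    ...   | here e≡l          = ⊥-elim (step-¬loop s (subst IsLoop (sym e≡l) (loop t v)))
    ...   | there (here e≡l′) = ⊥-elim (step-¬loop s (subst IsLoop (sym e≡l′) (loop t′ v′)))

    pair-independent : Independent ⟦ x ∷ y ∷ [] ⟧
    pair-independent = noBalanced , oneUnbalanced
      where
      noBalanced : ∀ (C : Cycle ⟦ x ∷ y ∷ [] ⟧) → ¬ Balanced C
      noBalanced (loopC _ _ _)            ()
      noBalanced (closed _ _ _ _ w l _ u) = closed-in-pair-unbalanced w l u

      loop∉closed : ∀ {t v u vs es g} → loop t v ∈ₛ ⟦ x ∷ y ∷ [] ⟧ →
                    Walk ⟦ x ∷ y ∷ [] ⟧ u u vs es g → 2 ≤ length es → Unique es → ⊥
      loop∉closed {t} {v} l∈ w l u =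
        walk-edges-¬loop w (closed-in-pair-covers w l u (∈⟦⟧⁻ l∈)) (loop t v)

      oneUnbalanced : ∀ (C D : Cycle ⟦ x ∷ y ∷ [] ⟧) → ¬ Balanced C → ¬ Balanced D →
                      Connected ⟦ x ∷ y ∷ [] ⟧ (cycleVertex C) (cycleVertex D) → SameCycle C D
      oneUnbalanced (loopC _ _ l∈) (loopC _ _ l′∈) _ _ conn
        with loops-in-pair-connected⇒≡ l∈ l′∈ conn
      ... | refl = λ _ → mk⇔ id id
      oneUnbalanced (loopC _ _ l∈) (closed _ _ _ _ w l _ u) _ _ _ = ⊥-elim (loop∉closed l∈ w l u)
      oneUnbalanced (closed _ _ _ _ w l _ u) (loopC _ _ l∈) _ _ _ = ⊥-elim (loop∉closed l∈ w l u)
      oneUnbalanced (closed _ _ _ _ w l _ u) (closed _ _ _ _ w′ l′ _ u′) _ _ _ _ =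
        mk⇔ (closed-in-pair-covers w′ l′ u′ ∘ walk-edges⊆ w)
            (closed-in-pair-covers w l u ∘ walk-edges⊆ w′)

  -- The edge {u,v}_a, stored as (u,v,a) or (v,u,a⁻¹) according to the order of the endpoints.
  link : (u v : Fin n) → .(u ≢ v) → Gain → Elem
  link u v u≢v a with <-cmp u v
  ... | tri< u<v _ _ = edge u v u<v a
  ... | tri≈ _ u≡v _ = Irrelevant.⊥-elim (u≢v u≡v)
  ... | tri> _ _ v<u = edge v u v<u (a ⁻¹)

  step-link : ∀ u v .(u≢v : u ≢ v) a → ∃[ g ] Step (link u v u≢v a) u v g × g ≡ a
  step-link u v u≢v a with <-cmp u v
  ... | tri< u<v _ _ = a , fwd u<v a , refl
  ... | tri≈ _ u≡v _ = Irrelevant.⊥-elim (u≢v u≡v)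
  ... | tri> _ _ v<u = (a ⁻¹) ⁻¹ , bwd v<u (a ⁻¹) , ⁻¹-involutive a

  step-link⁻¹ : ∀ u v .(u≢v : u ≢ v) a → ∃[ g ] Step (link u v u≢v a) v u g × g ≡ a ⁻¹
  step-link⁻¹ u v u≢v a with <-cmp u v
  ... | tri< u<v _ _ = a ⁻¹ , bwd u<v a , refl
  ... | tri≈ _ u≡v _ = Irrelevant.⊥-elim (u≢v u≡v)
  ... | tri> _ _ v<u = a ⁻¹ , fwd v<u (a ⁻¹) , refl

  source target : Elem → Fin n
  source (edge i _ _ _) = i
  source (loop _ v)     = v
  target (edge _ j _ _) = j
  target (loop _ v)     = v

  gain : Elem → Gain
  gain (edge _ _ _ g) = g
  gain (loop _ _)     = ε

  link-ends : ∀ {u v u′ v′} .{u≢v u′≢v′} {a a′} → link u v u≢v a ≡ link u′ v′ u′≢v′ a′ →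
              (u ≡ u′ × v ≡ v′) ⊎ (u ≡ v′ × v ≡ u′)
  link-ends {u} {v} {u′} {v′} {u≢v} {u′≢v′} eq with <-cmp u v | <-cmp u′ v′
  ... | tri< _ _ _ | tri< _ _ _ = inj₁ (cong source eq , cong target eq)
  ... | tri< _ _ _ | tri> _ _ _ = inj₂ (cong source eq , cong target eq)
  ... | tri> _ _ _ | tri< _ _ _ = inj₂ (cong target eq , cong source eq)
  ... | tri> _ _ _ | tri> _ _ _ = inj₁ (cong target eq , cong source eq)
  ... | tri≈ _ u≡v _ | _ = Irrelevant.⊥-elim (u≢v u≡v)
  ... | _ | tri≈ _ u′≡v′ _ = Irrelevant.⊥-elim (u′≢v′ u′≡v′)

  link-gain-injective : ∀ {u v} .{u≢v u≢v′} {a b} → link u v u≢v a ≡ link u v u≢v′ b → a ≡ b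
  link-gain-injective {u} {v} {u≢v} eq with <-cmp u v
  ... | tri< _ _ _   = cong gain eq
  ... | tri≈ _ u≡v _ = Irrelevant.⊥-elim (u≢v u≡v)
  ... | tri> _ _ _   = ⁻¹-injective (cong gain eq)

  link-sym : ∀ u v .(u≢v : u ≢ v) .(v≢u : v ≢ u) a → link u v u≢v a ≡ link v u v≢u (a ⁻¹)
  link-sym u v u≢v v≢u a with <-cmp u v | <-cmp v u
  ... | tri< u<v _ _ | tri> _ _ u<v′ = edge-cong u<v u<v′ (sym (⁻¹-involutive a))
  ... | tri> _ _ v<u | tri< v<u′ _ _ = edge-cong v<u v<u′ refl
  ... | tri< u<v _ _ | tri< v<u _ _ = ⊥-elim (<-asym u<v v<u)
  ... | tri> _ _ v<u | tri> _ _ u<v = ⊥-elim (<-asym u<v v<u)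
  ... | tri≈ _ u≡v _ | _ = Irrelevant.⊥-elim (u≢v u≡v)
  ... | _ | tri≈ _ v≡u _ = Irrelevant.⊥-elim (v≢u v≡u)

  <⇒≢ : ∀ {i j : Fin n} → i <ᶠ j → i ≢ j
  <⇒≢ i<j i≡j = <-irrefl i≡j i<j

  edge≡link : ∀ i j (i<j : i <ᶠ j) g → edge i j i<j g ≡ link i j (<⇒≢ i<j) g
  edge≡link i j i<j g with <-cmp i j
  ... | tri< i<j′ _ _ = edge-cong i<j i<j′ refl
  ... | tri≈ _ i≡j _  = ⊥-elim (<⇒≢ i<j i≡j)
  ... | tri> _ _ j<i  = ⊥-elim (<-asym i<j j<i)

  -- The two loops are distinct unbalanced cycles in one component.
  loops-joined-dependent : ∀ t u v (u≢v : u ≢ v) a → Dependent₃ (loop t u) (link u v u≢v a) (loop t v)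
  loops-joined-dependent t u v u≢v a (_ , oneUnbalanced) with step-link u v u≢v a
  ... | _ , s , _ = loops-differ (Equivalence.to (sameCycle (loop t u)) (here refl))
    where
    triple : List Elem
    triple = loop t u ∷ link u v u≢v a ∷ loop t v ∷ []
    sameCycle : ∀ e → (e ∈ loop t u ∷ []) ⇔ (e ∈ loop t v ∷ [])
    sameCycle = oneUnbalanced (loopC t u (∈⟦⟧⁺ triple (here refl)))
                              (loopC t v (∈⟦⟧⁺ triple (there (there (here refl)))))
                              (λ ()) (λ ()) (_ , _ , _ , step (∈⟦⟧⁺ triple (there (here refl))) s [])
    loops-differ : ¬ loop t u ∈ loop t v ∷ []
    loops-differ (here l≡l′) = u≢v (cong source l≡l′)

  links-≢ : ∀ {u v u′ v′} .{u≢v u′≢v′} {a a′} → ¬ (u ≡ u′ × v ≡ v′) → ¬ (u ≡ v′ × v ≡ u′) →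
            link u v u≢v a ≢ link u′ v′ u′≢v′ a′
  links-≢ ¬same ¬swapped = [ ¬same , ¬swapped ]′ ∘ link-ends

  triangle-dependent : ∀ u v w (u≢v : u ≢ v) (v≢w : v ≢ w) (u≢w : u ≢ w) a b c → c ≡ a ∙ b →
                       Dependent₃ (link u v u≢v a) (link v w v≢w b) (link u w u≢w c)
  triangle-dependent u v w u≢v v≢w u≢w a b c c≡ab (noBalanced , _)
    with step-link u v u≢v a | step-link v w v≢w b | step-link⁻¹ u w u≢w c
  ... | _ , s₁ , refl | _ , s₂ , refl | _ , s₃ , refl = noBalanced triangle balanced
    where
    sides : List Elem
    sides = link u v u≢v a ∷ link v w v≢w b ∷ link u w u≢w c ∷ []
    triangle : Cycle ⟦ sides ⟧
    triangle = closed u (u ∷ v ∷ w ∷ []) sides _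
      (step (∈⟦⟧⁺ sides (here refl)) s₁
        (step (∈⟦⟧⁺ sides (there (here refl))) s₂
          (step (∈⟦⟧⁺ sides (there (there (here refl)))) s₃ [])))
      (s≤s (s≤s z≤n))
      ((u≢v ∷ u≢w ∷ []) ∷ (v≢w ∷ []) ∷ [] ∷ [])
      ((uv≢vw ∷ uv≢uw ∷ []) ∷ (vw≢uw ∷ []) ∷ [] ∷ [])
      where
      uv≢vw : link u v u≢v a ≢ link v w v≢w b
      uv≢uw : link u v u≢v a ≢ link u w u≢w c
      vw≢uw : link v w v≢w b ≢ link u w u≢w c
      uv≢vw = links-≢ {u} {v} {v} {w} (u≢v ∘ proj₁) (u≢w ∘ proj₁)
      uv≢uw = links-≢ {u} {v} {u} {w} (v≢w ∘ proj₂) (u≢w ∘ proj₁)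
      vw≢uw = links-≢ {v} {w} {u} {w} (u≢v ∘ sym ∘ proj₁) (v≢w ∘ proj₁)
    balanced : a ∙ (b ∙ ((c ⁻¹) ∙ ε)) ≡ ε
    balanced rewrite c≡ab = triangle-balanced a b

  -- The digons {a,b} and {a,c} are distinct unbalanced cycles at the same vertex.
  parallel-dependent : ∀ u v (u≢v : u ≢ v) a b c → a ≢ b → a ≢ c → b ≢ c →
                       Dependent₃ (link u v u≢v a) (link u v u≢v b) (link u v u≢v c)
  parallel-dependent u v u≢v a b c a≢b a≢c b≢c (_ , oneUnbalanced)
    with step-link u v u≢v a | step-link⁻¹ u v u≢v b | step-link⁻¹ u v u≢v c
  ... | _ , s , refl | _ , s′ , refl | _ , s″ , refl =
    c∉ab (Equivalence.from (sameCycle (link u v u≢v c)) (there (here refl)))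
    where
    edges : List Elem
    edges = link u v u≢v a ∷ link u v u≢v b ∷ link u v u≢v c ∷ []
    a∈ : link u v u≢v a ∈ₛ ⟦ edges ⟧
    b∈ : link u v u≢v b ∈ₛ ⟦ edges ⟧
    c∈ : link u v u≢v c ∈ₛ ⟦ edges ⟧
    a∈ = ∈⟦⟧⁺ edges (here refl)
    b∈ = ∈⟦⟧⁺ edges (there (here refl))
    c∈ = ∈⟦⟧⁺ edges (there (there (here refl)))
    sameCycle : ∀ e → (e ∈ link u v u≢v a ∷ link u v u≢v b ∷ []) ⇔
                      (e ∈ link u v u≢v a ∷ link u v u≢v c ∷ [])
    sameCycle = oneUnbalanced
      (digon u≢v (a≢b ∘ link-gain-injective {u} {v}) a∈ b∈ s s′)
      (digon u≢v (a≢c ∘ link-gain-injective {u} {v}) a∈ c∈ s s″)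
      (a≢b ∘ digon-balanced′ a b) (a≢c ∘ digon-balanced′ a c) (_ , _ , _ , [])
    c∉ab : ¬ link u v u≢v c ∈ link u v u≢v a ∷ link u v u≢v b ∷ []
    c∉ab (here c≡a)         = a≢c (sym (link-gain-injective {u} {v} c≡a))
    c∉ab (there (here c≡b)) = b≢c (sym (link-gain-injective {u} {v} c≡b))

  flat-closed : ∀ {F x y e} → Flat F → x ∈ₛ F → y ∈ₛ F → Dependent₃ x y e → e ∈ₛ F
  flat-closed {F} {x} {y} {e} flat x∈F y∈F dep =
    flat e (⟦ x ∷ y ∷ [] ⟧ , ⟦ x ∷ y ∷ e ∷ [] ⟧ , pair⊆F , pair-independent x y , insert , dep)
    where
    pair⊆F : ⟦ x ∷ y ∷ [] ⟧ ⊆ₛ F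
    pair⊆F e′ m with ∈-pair⁻ (∈⟦⟧⁻ {e′} {x ∷ y ∷ []} m)
    ... | inj₁ refl = x∈F
    ... | inj₂ refl = y∈F
    insert : IsInsert ⟦ x ∷ y ∷ [] ⟧ e ⟦ x ∷ y ∷ e ∷ [] ⟧
    insert = ⟦⟧-mono (xs⊆xs++ys (x ∷ y ∷ []) (e ∷ []))
           , ∈⟦⟧⁺ (x ∷ y ∷ e ∷ []) (there (there (here refl)))
           , λ e′ m → ⊎-map (∈⟦⟧⁺ (x ∷ y ∷ [])) singleton⁻ (∈-++⁻ (x ∷ y ∷ []) (∈⟦⟧⁻ {e′} m))

  -- Every pair is independent, so nothing lies in the closure of a set with at most one element.
  subsingleton-flat : ∀ {F} r → (∀ e → e ∈ₛ F → e ≡ r) → Flat F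
  subsingleton-flat r ≡r e (I , J , I⊆F , _ , (_ , _ , J⊆I+e) , depJ) =
    ⊥-elim (depJ (independent-⊆ J⊆re (pair-independent r e)))
    where
    J⊆re : J ⊆ₛ ⟦ r ∷ e ∷ [] ⟧
    J⊆re x m = ∈⟦⟧⁺ (r ∷ e ∷ []) ([ (λ x∈I → here (≡r x (I⊆F x x∈I))) , there ∘ here ]′ (J⊆I+e x m))

  StarIn : Subset → Fin n → Set
  StarIn F x = (∀ v (x≢v : x ≢ v) g → link x v x≢v g ∈ₛ F) × (∀ t → loop t x ∈ₛ F)

  -- An edge {u,v}_g away from x closes a balanced triangle with {u,x}_g and {x,v}_ε,
  -- and a loop at v ≠ x is joined to the loop at x by {x,v}_ε.
  flat⊇star⇒full : ∀ {F x} → Flat F → StarIn F x → ∀ e → e ∈ₛ F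
  flat⊇star⇒full {F} {x} flat (edges∈ , loops∈) (edge u v u<v g) =
    subst (_∈ₛ F) (sym (edge≡link u v u<v g)) (link∈ u v (<⇒≢ u<v) g)
    where
    reversed∈ : ∀ u (u≢x : u ≢ x) g → link u x u≢x g ∈ₛ F
    reversed∈ u u≢x g = subst (_∈ₛ F) (sym (link-sym u x u≢x (≢-sym u≢x) g)) (edges∈ u (≢-sym u≢x) (g ⁻¹))

    link∈ : ∀ u v (u≢v : u ≢ v) g → link u v u≢v g ∈ₛ F
    link∈ u v u≢v g with u ≟ᶠ x | v ≟ᶠ x
    ... | yes refl | _        = edges∈ v u≢v g
    ... | no _     | yes refl = reversed∈ u u≢v g
    ... | no u≢x   | no v≢x   = flat-closed flat (reversed∈ u u≢x g) (edges∈ v (≢-sym v≢x) ε)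
                                  (triangle-dependent u x v u≢x (≢-sym v≢x) u≢v g ε g (sym (identityʳ g)))
  flat⊇star⇒full {F} {x} flat (edges∈ , loops∈) (loop t v) with v ≟ᶠ x
  ... | yes refl = loops∈ t
  ... | no v≢x   = flat-closed flat (loops∈ t) (edges∈ v (≢-sym v≢x) ε)
                     (loops-joined-dependent t x v (≢-sym v≢x) ε)

  Absorbs : Subset → Elem → Set
  Absorbs F f = ∀ y z → Dependent₃ f y z → y ∈ₛ F

  absorbs₃ : ∀ {F f} → Absorbs F f → ∀ y z → Dependent₃ f y z → z ∈ₛ F
  absorbs₃ absorb y z = absorb z y ∘ dependent₃-swap₂₃

  absorbing-loop⇒star : ∀ {F t x} → loop t x ∈ₛ F → Absorbs F (loop t x) → StarIn F x
  absorbing-loop⇒star {F} {t} {x} l∈F absorb =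
    (λ v x≢v g → absorb (link x v x≢v g) (loop t v) (loops-joined-dependent t x v x≢v g)) ,
    (λ t′ → subst (λ s → loop s x ∈ₛ F) (T-irrelevant t t′) l∈F)

  module AbsorbingLink {F} (flat : Flat F) {x y} (x≢y : x ≢ y) {a}
                       (f∈F : link x y x≢y a ∈ₛ F) (absorb : Absorbs F (link x y x≢y a)) where

    triangle-far-side : ∀ w (x≢w : x ≢ w) (y≢w : y ≢ w) b → link y w y≢w b ∈ₛ F
    triangle-far-side w x≢w y≢w b =
      absorb _ (link x w x≢w (a ∙ b)) (triangle-dependent x y w x≢y y≢w x≢w a b (a ∙ b) refl)

    triangle-near-side : ∀ w (x≢w : x ≢ w) (y≢w : y ≢ w) c → link x w x≢w c ∈ₛ F
    triangle-near-side w x≢w y≢w c =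
      absorbs₃ absorb (link y w y≢w ((a ⁻¹) ∙ c)) _
        (triangle-dependent x y w x≢y y≢w x≢w a ((a ⁻¹) ∙ c) c (sym (∙-⁻¹-cancel a c)))

    loops-at-ends : ∀ t → loop t x ∈ₛ F × loop t y ∈ₛ F
    loops-at-ends t = absorb _ (loop t y) joined , absorbs₃ absorb (loop t x) _ joined
      where
      joined : Dependent₃ (link x y x≢y a) (loop t x) (loop t y)
      joined = dependent₃-swap₁₂ (loops-joined-dependent t x y x≢y a)

    parallel-via-loops : T lp → ∀ g → link x y x≢y g ∈ₛ F
    parallel-via-loops t g with loops-at-ends t
    ... | lx∈F , ly∈F = flat-closed flat lx∈F ly∈F (dependent₃-swap₂₃ (loops-joined-dependent t x y x≢y g))

    parallel-via-vertex : ∀ w → w ≢ x → w ≢ y → ∀ g → link x y x≢y g ∈ₛ F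
    parallel-via-vertex w w≢x w≢y g =
      flat-closed flat (triangle-near-side w (≢-sym w≢x) (≢-sym w≢y) g) wy∈F
        (triangle-dependent x w y (≢-sym w≢x) w≢y x≢y g ε g (sym (identityʳ g)))
      where
      wy∈F : link w y w≢y ε ∈ₛ F
      wy∈F = subst (_∈ₛ F) (sym (link-sym w y w≢y (≢-sym w≢y) ε))
                   (triangle-far-side w (≢-sym w≢x) (≢-sym w≢y) (ε ⁻¹))

    parallel-via-gain : ∀ g h → g ≢ a → h ≢ a → h ≢ g → link x y x≢y g ∈ₛ F
    parallel-via-gain g h g≢a h≢a h≢g =
      absorb _ (link x y x≢y h) (parallel-dependent x y x≢y a g h (≢-sym g≢a) (≢-sym h≢a) (≢-sym h≢g))

    parallel : ¬ Exceptional Γ n lp → ∀ g → link x y x≢y g ∈ₛ F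
    parallel ¬exc g with g ≟ᶠ a
    ... | yes refl = f∈F
    ... | no g≢a with T? lp
    ...   | yes t = parallel-via-loops t g
    ...   | no ¬t with third⊎≡2 x y x≢y
    ...     | inj₁ (w , w≢x , w≢y) = parallel-via-vertex w w≢x w≢y g
    ...     | inj₂ n≡2 with third⊎≡2 a g (≢-sym g≢a)
    ...       | inj₁ (h , h≢a , h≢g) = parallel-via-gain g h g≢a h≢a h≢g
    ...       | inj₂ order≡2 = ⊥-elim (¬exc (¬-not (¬t ∘ Equivalence.from T-≡) , n≡2 , order≡2))

    star : ¬ Exceptional Γ n lp → StarIn F x
    star ¬exc = edges∈ , proj₁ ∘ loops-at-ends
      where
      edges∈ : ∀ v (x≢v : x ≢ v) g → link x v x≢v g ∈ₛ F
      edges∈ v x≢v g with v ≟ᶠ y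
      ... | yes refl = parallel ¬exc g
      ... | no v≢y   = triangle-near-side v x≢v (≢-sym v≢y) g

  absorbing-flat-full : ¬ Exceptional Γ n lp → ∀ {F f} → Flat F → f ∈ₛ F → Absorbs F f → ∀ e → e ∈ₛ F
  absorbing-flat-full _ {f = loop t x} flat f∈F absorb = flat⊇star⇒full flat (absorbing-loop⇒star f∈F absorb)
  absorbing-flat-full ¬exc {F} {edge x y x<y a} flat f∈F absorb =
    flat⊇star⇒full flat
      (AbsorbingLink.star flat (<⇒≢ x<y) (subst (_∈ₛ F) f≡ f∈F) (subst (Absorbs F) f≡ absorb) ¬exc)
    where
    f≡ : edge x y x<y a ≡ link x y (<⇒≢ x<y) a
    f≡ = edge≡link x y x<y a

  covering-flats-absorb : ∀ {F₁ F₂ f} → Flat F₁ → Flat F₂ → (∀ e → e ∈ₛ F₁ ⊎ e ∈ₛ F₂) →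
                          f ∈ₛ F₁ → ¬ f ∈ₛ F₂ → Absorbs F₁ f
  covering-flats-absorb flat₁ flat₂ cover f∈F₁ f∉F₂ y z dep with cover y
  ... | inj₁ y∈F₁ = y∈F₁
  ... | inj₂ y∈F₂ with cover z
  ...   | inj₁ z∈F₁ = flat-closed flat₁ f∈F₁ z∈F₁ (dependent₃-swap₂₃ dep)
  ...   | inj₂ z∈F₂ =
    ⊥-elim (f∉F₂ (flat-closed flat₂ y∈F₂ z∈F₂ (dependent₃-swap₂₃ (dependent₃-swap₁₂ dep))))

  round : ¬ Exceptional Γ n lp → Round
  round ¬exc (F₁ , F₂ , flat₁ , flat₂ , (e , e∉F₁) , (f , f∉F₂) , cover) = not-¬ e∉F₁ (full e)
    where
    f∈F₁ : f ∈ₛ F₁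
    f∈F₁ = [ id , (λ f∈F₂ → ⊥-elim (not-¬ f∉F₂ f∈F₂)) ]′ (cover f)
    full : ∀ e → e ∈ₛ F₁
    full = absorbing-flat-full ¬exc flat₁ f∈F₁
             (covering-flats-absorb flat₁ flat₂ cover f∈F₁ (not-¬ f∉F₂))

module K₂ (Γ : FiniteGroup) (order≡2 : FiniteGroup.order Γ ≡ 2) where
  open FiniteGroup Γ
  open Frame Γ 2 false
  open FrameMatroid Γ 2 false using (gain; edge-cong; subsingleton-flat)

  edge₀₁ : Gain → Elem
  edge₀₁ = edge zero (suc zero) (s≤s z≤n)

  ≡edge₀₁ : ∀ e → e ≡ edge₀₁ (gain e)
  ≡edge₀₁ (edge zero       (suc zero) p        _) = edge-cong p (s≤s z≤n) refl
  ≡edge₀₁ (edge zero       zero       ()       _)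
  ≡edge₀₁ (edge (suc zero) zero       ()       _)
  ≡edge₀₁ (edge (suc zero) (suc zero) (s≤s ()) _)

  h : Gain
  h = proj₁ (∃≢ order≡2 ε)

  h≢ε : h ≢ ε
  h≢ε = proj₂ (∃≢ order≡2 ε)

  TrivialGain NontrivialGain : Subset
  TrivialGain e   = does (gain e ≟ᶠ ε)
  NontrivialGain e = not (TrivialGain e)

  TrivialGain⊆ : ∀ e → e ∈ₛ TrivialGain → e ≡ edge₀₁ ε
  TrivialGain⊆ e with gain e ≟ᶠ ε
  ... | yes gain≡ε = λ _ → trans (≡edge₀₁ e) (cong edge₀₁ gain≡ε)
  ... | no _       = λ ()

  NontrivialGain⊆ : ∀ e → e ∈ₛ NontrivialGain → e ≡ edge₀₁ h
  NontrivialGain⊆ e with gain e ≟ᶠ ε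
  ... | yes _      = λ ()
  ... | no gain≢ε  = λ _ → trans (≡edge₀₁ e) (cong edge₀₁ (≢-same⇒≡ order≡2 gain≢ε h≢ε))

  cover : ∀ e → e ∈ₛ TrivialGain ⊎ e ∈ₛ NontrivialGain
  cover e with gain e ≟ᶠ ε
  ... | yes _ = inj₁ refl
  ... | no _  = inj₂ refl

  ¬round : ¬ Round
  ¬round round = round
    ( TrivialGain , NontrivialGain
    , subsingleton-flat _ TrivialGain⊆ , subsingleton-flat _ NontrivialGain⊆
    , (edge₀₁ h , dec-false (h ≟ᶠ ε) h≢ε) , (edge₀₁ ε , cong not (dec-true (ε ≟ᶠ ε) refl))
    , cover )

proposition4p4 : (Γ : FiniteGroup) (n : ℕ) (withLoops : Bool) →
    IsRoundFrame Γ n withLoops ⇔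
      (¬ (withLoops ≡ false × n ≡ 2 × FiniteGroup.order Γ ≡ 2))
proposition4p4 Γ n withLoops = mk⇔ round⇒¬exceptional (FrameMatroid.round Γ n withLoops)
  where
  round⇒¬exceptional : IsRoundFrame Γ n withLoops → ¬ Exceptional Γ n withLoops
  round⇒¬exceptional isRound (refl , refl , order≡2) = K₂.¬round Γ order≡2 isRound
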